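{- Let $S\subseteq\mathbb{F}_{q^n}$ satisfy: (i) $S$ is closed under taking $\mathbb{F}_q$-linear combinations; (ii) for every $\beta\in\mathbb{F}_{q^n}$, either $\beta S=S$ or $\beta S\cap S=\{0\}$; (iii) $|S|=q^d$ with $d\mid n$. Then $S=\alpha\,\mathbb{F}_{q^d}$ for some $\alpha\in\mathbb{F}_{q^n}^*$. -}

module Defs where

open import Level using (0ℓ)
open import Data.Nat as ℕ using (ℕ; zero; suc)
open import Data.Nat.Primality using (Prime)
open import Data.Bool using (Bool; true)
open import Data.Fin using (Fin)
open import Data.Product using (Σ; ∃; _×_)
open import Function.Bundles using (_↔_; _⇔_)
open import Relation.Binary.PropositionalEquality using (_≡_)
open import Relation.Nullary using (¬_)
import Algebra.Structures as AS

record Field : Set₁ where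
  infixl 6 _+_
  infixl 7 _*_
  field
    Carrier : Set
    _+_ _*_ : Carrier → Carrier → Carrier
    -_      : Carrier → Carrier
    0# 1#   : Carrier
    isCommutativeRing : AS.IsCommutativeRing (_≡_ {A = Carrier}) _+_ _*_ -_ 0# 1#
    0≢1     : ¬ (0# ≡ 1#)
    inverse : ∀ x → ¬ (x ≡ 0#) → ∃ λ y → x * y ≡ 1#

  _^_ : Carrier → ℕ → Carrier
  x ^ zero  = 1#
  x ^ suc k = x * (x ^ k)

IsPrimePower : ℕ → Set
IsPrimePower q = Σ ℕ λ p → Σ ℕ λ k → Prime p × (q ≡ p ℕ.^ suc k)

module _ (K : Field) where
  open Field K

  Subset : Set
  Subset = Carrier → Bool

  _∈_ : Carrier → Subset → Set
  x ∈ S = S x ≡ true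

  HasSize : Subset → ℕ → Set
  HasSize S m = Σ Carrier (λ x → x ∈ S) ↔ Fin m

  -- the subfield F_{q^e} of K: roots of X^{q^e} - X
  Subfield : ℕ → ℕ → Carrier → Set
  Subfield q e x = x ^ (q ℕ.^ e) ≡ x

  FqLinearClosed : ℕ → Subset → Set
  FqLinearClosed q S = ∀ a b x y → Subfield q 1 a → Subfield q 1 b →
    x ∈ S → y ∈ S → (a * x + b * y) ∈ S

  _∈[_·_] : Carrier → Carrier → Subset → Set
  y ∈[ β · S ] = ∃ λ s → s ∈ S × y ≡ β * s

  ScaleEq : Carrier → Subset → Set
  ScaleEq β S = ∀ y → y ∈[ β · S ] ⇔ y ∈ S

  ScaleMeetZero : Carrier → Subset → Set
  ScaleMeetZero β S = ∀ y → (y ∈[ β · S ] × y ∈ S) ⇔ (y ≡ 0#)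

module Submission where

open import Defs
open import Data.Nat using (ℕ)
open import Data.Nat.Divisibility using (_∣_)
open import Data.Fin using (Fin)
open import Data.Product using (Σ; ∃; _×_)
open import Data.Sum using (_⊎_)
open import Function.Bundles using (_↔_; _⇔_)
open import Relation.Binary.PropositionalEquality using (_≡_)
open import Relation.Nullary using (¬_)

open import Algebra.Bundles using (CommutativeRing)
import Algebra.Structures as AS
open import Axiom.UniquenessOfIdentityProofs using (module Decidable⇒UIP)
import Data.Bool as Bool
open import Data.Empty using (⊥-elim)
import Data.Fin as Fin
open import Data.Fin using (zero; suc; punchIn)
open import Data.Fin.Permutation using (Permutation; _⟨$⟩ʳ_)
open import Data.Fin.Properties using (suc-injective; 0≢1+n; any?; punchInᵢ≢i)
open import Data.List using (List; []; _∷_; length; replicate)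
open import Data.List.Properties using (length-replicate)
open import Data.Maybe using (nothing)
open import Data.Nat using (zero; suc; _≤_; _<_; z≤n; s≤s; z<s)
open import Data.Nat.Base using (nonTrivial⇒n>1)
open import Data.Nat.Divisibility using (0∣⇒≡0)
open import Data.Nat.Primality using (prime⇒nonTrivial)
open import Data.Nat.Properties using (n≮n; n≢0⇒n>0; <-trans; ^-identityʳ; ^-monoʳ-<)
open import Data.Product using (_,_; proj₁; proj₂)
open import Data.Sum using (inj₁; inj₂)
import Data.Vec.Functional as Vector
open Vector using (removeAt)
open import Function.Base using (_∘_)
open import Function.Bundles using (Inverse; Injection; Equivalence; mk↔ₛ′; mk⇔)
open import Function.Construct.Composition using (_↔-∘_)
open import Function.Construct.Symmetry using (↔-sym)
open import Function.Definitions using (Injective)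
open import Function.Properties.Inverse using (↔⇒↣)
open import Level using (0ℓ)
open import Relation.Binary.Definitions using (DecidableEquality)
open import Relation.Binary.PropositionalEquality
  using (_≢_; refl; sym; trans; cong; cong₂; subst; module ≡-Reasoning)
open import Relation.Nullary using (yes; no)
open import Relation.Nullary.Decidable using (via-injection)
open import Tactic.RingSolver.Core.AlmostCommutativeRing
  using (AlmostCommutativeRing; fromCommutativeRing)

-- Fix s ∈ S ∖ {0} and let Q = |S|. For nonzero y ∈ S, β = s⁻¹ y gives y ∈ β S ∩ S, so
-- β S = S by the dichotomy; multiplication by β then permutes S ∖ {0}, and comparing
-- products gives β ^ Q = β. So s⁻¹ S consists of Q distinct roots of X ^ Q - X, which
-- has no further roots; that is, s⁻¹ S is exactly the set of solutions of x ^ Q = x.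
-- Linearity is only used to put 0 in S.

module FieldArithmetic (K : Field) where
  open Field K public
  open AS.IsCommutativeRing isCommutativeRing public
    using ( +-identityˡ; +-identityʳ; -‿inverseˡ; -‿inverseʳ; distribˡ
          ; *-assoc; *-comm; *-identityˡ; *-identityʳ; zeroˡ; zeroʳ )
  open ≡-Reasoning

  commutativeRing : CommutativeRing 0ℓ 0ℓ
  commutativeRing = record { isCommutativeRing = isCommutativeRing }

  open CommutativeRing commutativeRing public using (*-commutativeMonoid)
  open import Algebra.Properties.Group (CommutativeRing.+-group commutativeRing)
    using (x∙y⁻¹≈ε⇒x≈y; //-rightDividesˡ)
  open import Algebra.Properties.Ring (CommutativeRing.ring commutativeRing) public
    using (-1*x≈-x)

  -- No coefficient is ever recognised as 0, so only identities needing no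
  -- cancellation can be solved.
  ring : AlmostCommutativeRing 0ℓ 0ℓ
  ring = fromCommutativeRing commutativeRing (λ _ → nothing)

  infixl 6 _-_
  _-_ : Carrier → Carrier → Carrier
  x - y = x + - y

  x-y≡0⇒x≡y : ∀ {x y} → x - y ≡ 0# → x ≡ y
  x-y≡0⇒x≡y = x∙y⁻¹≈ε⇒x≈y _ _

  x-y+y≡x : ∀ x y → x - y + y ≡ x
  x-y+y≡x x y = //-rightDividesˡ y x

  module _ {x x′ : Carrier} (x*x′≡1 : x * x′ ≡ 1#) where

    x′*[x*y]≡y : ∀ y → x′ * (x * y) ≡ y
    x′*[x*y]≡y y = begin
      x′ * (x * y)  ≡⟨ *-assoc x′ x y ⟨
      x′ * x * y    ≡⟨ cong (_* y) (trans (*-comm x′ x) x*x′≡1) ⟩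
      1# * y        ≡⟨ *-identityˡ y ⟩
      y             ∎

    x*[x′*y]≡y : ∀ y → x * (x′ * y) ≡ y
    x*[x′*y]≡y y = begin
      x * (x′ * y)  ≡⟨ *-assoc x x′ y ⟨
      x * x′ * y    ≡⟨ cong (_* y) x*x′≡1 ⟩
      1# * y        ≡⟨ *-identityˡ y ⟩
      y             ∎

  *-cancelˡ : ∀ {x} y z → x ≢ 0# → x * y ≡ x * z → y ≡ z
  *-cancelˡ {x} y z x≢0 xy≡xz = begin
    y             ≡⟨ x′*[x*y]≡y x*x′≡1 y ⟨
    x′ * (x * y)  ≡⟨ cong (x′ *_) xy≡xz ⟩
    x′ * (x * z)  ≡⟨ x′*[x*y]≡y x*x′≡1 z ⟩
    z             ∎
    where
    x′ = proj₁ (inverse x x≢0)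
    x*x′≡1 = proj₂ (inverse x x≢0)

  x*y≡0⇒y≡0 : ∀ {x y} → x ≢ 0# → x * y ≡ 0# → y ≡ 0#
  x*y≡0⇒y≡0 {x} {y} x≢0 xy≡0 = *-cancelˡ y 0# x≢0 (trans xy≡0 (sym (zeroʳ x)))

  *-≢0 : ∀ {x y} → x ≢ 0# → y ≢ 0# → x * y ≢ 0#
  *-≢0 x≢0 y≢0 = y≢0 ∘ x*y≡0⇒y≡0 x≢0

  0^n≡0 : ∀ {n} → 0 < n → 0# ^ n ≡ 0#
  0^n≡0 {suc n} _ = zeroˡ (0# ^ n)

module MonicPolynomial (K : Field) where
  open FieldArithmetic K
  open import Tactic.RingSolver.NonReflective ring using (solve; _⊜_; _⊕_; _⊗_)
  open ≡-Reasoning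

  -- cs stands for the monic polynomial X ^ length cs + Σᵢ csᵢ Xⁱ.
  evalMonic : List Carrier → Carrier → Carrier
  evalMonic []       x = 1#
  evalMonic (c ∷ cs) x = c + x * evalMonic cs x

  -- Synthetic division of c ∷ cs by X - a, returning quotient and remainder.
  divide : Carrier → Carrier → List Carrier → List Carrier × Carrier
  divide a c []        = [] , c + a
  divide a c (c′ ∷ cs) = let (ds , r) = divide a c′ cs in r ∷ ds , c + a * r

  quotient : Carrier → Carrier → List Carrier → List Carrier
  quotient a c cs = proj₁ (divide a c cs)

  remainder : Carrier → Carrier → List Carrier → Carrier
  remainder a c cs = proj₂ (divide a c cs)

  length-quotient : ∀ a c cs → length (quotient a c cs) ≡ length cs
  length-quotient a c []        = refl
  length-quotient a c (c′ ∷ cs) = cong suc (length-quotient a c′ cs)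

  -- Writing x = u + a avoids the cancellation of a - a.
  divide-correct-shifted : ∀ a c cs u →
    evalMonic (c ∷ cs) (u + a) ≡ u * evalMonic (quotient a c cs) (u + a) + remainder a c cs
  divide-correct-shifted a c [] u = begin
    c + (u + a) * 1#  ≡⟨ cong (c +_) (*-identityʳ (u + a)) ⟩
    c + (u + a)       ≡⟨ solve 3 (λ a c u → (c ⊕ (u ⊕ a)) ⊜ (u ⊕ (c ⊕ a))) refl a c u ⟩
    u + (c + a)       ≡⟨ cong (_+ (c + a)) (*-identityʳ u) ⟨
    u * 1# + (c + a)  ∎
  divide-correct-shifted a c (c′ ∷ cs) u = begin
    c + x * evalMonic (c′ ∷ cs) x  ≡⟨ cong (λ t → c + x * t) (divide-correct-shifted a c′ cs u) ⟩
    c + x * (u * q + r)            ≡⟨ solve 5 (λ a c u q r → (c ⊕ (u ⊕ a) ⊗ (u ⊗ q ⊕ r))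
                                                ⊜ (u ⊗ (r ⊕ (u ⊕ a) ⊗ q) ⊕ (c ⊕ a ⊗ r))) refl a c u q r ⟩
    u * (r + x * q) + (c + a * r)  ∎
    where
    x = u + a
    q = evalMonic (quotient a c′ cs) x
    r = remainder a c′ cs

  divide-correct : ∀ a c cs x →
    evalMonic (c ∷ cs) x ≡ (x - a) * evalMonic (quotient a c cs) x + remainder a c cs
  divide-correct a c cs x =
    subst (λ t → evalMonic (c ∷ cs) t ≡ (x - a) * evalMonic (quotient a c cs) t + remainder a c cs)
          (x-y+y≡x x a) (divide-correct-shifted a c cs (x - a))

  remainder≡eval : ∀ a c cs → remainder a c cs ≡ evalMonic (c ∷ cs) a
  remainder≡eval a c cs = begin
    remainder a c cs                  ≡⟨ +-identityˡ _ ⟨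
    0# + remainder a c cs             ≡⟨ cong (_+ remainder a c cs) (zeroˡ q) ⟨
    0# * q + remainder a c cs         ≡⟨ cong (λ t → t * q + remainder a c cs) (-‿inverseʳ a) ⟨
    (a - a) * q + remainder a c cs    ≡⟨ divide-correct a c cs a ⟨
    evalMonic (c ∷ cs) a              ∎
    where q = evalMonic (quotient a c cs) a

  factor-root : ∀ a c cs → evalMonic (c ∷ cs) a ≡ 0# →
    ∀ x → evalMonic (c ∷ cs) x ≡ (x - a) * evalMonic (quotient a c cs) x
  factor-root a c cs root x = begin
    evalMonic (c ∷ cs) x            ≡⟨ divide-correct a c cs x ⟩
    (x - a) * q + remainder a c cs  ≡⟨ cong ((x - a) * q +_) (trans (remainder≡eval a c cs) root) ⟩
    (x - a) * q + 0#                ≡⟨ +-identityʳ _ ⟩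
    (x - a) * q                     ∎
    where q = evalMonic (quotient a c cs) x

  roots-bound : ∀ {k} cs (f : Fin k → Carrier) → Injective _≡_ _≡_ f →
    (∀ i → evalMonic cs (f i) ≡ 0#) → k ≤ length cs
  roots-bound {zero}  cs       f inj root = z≤n
  roots-bound {suc k} []       f inj root = ⊥-elim (0≢1 (sym (root zero)))
  roots-bound {suc k} (c ∷ cs) f inj root =
    s≤s (subst (k ≤_) (length-quotient a c cs)
               (roots-bound (quotient a c cs) (f ∘ suc) (suc-injective ∘ inj) quotient-root))
    where
    a = f zero
    quotient-root : ∀ i → evalMonic (quotient a c cs) (f (suc i)) ≡ 0#
    quotient-root i = x*y≡0⇒y≡0 (λ fᵢ-a≡0 → 0≢1+n (sym (inj (x-y≡0⇒x≡y fᵢ-a≡0))))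
                                (trans (sym (factor-root a c cs (root zero) (f (suc i)))) (root (suc i)))

  roots-exhausted : DecidableEquality Carrier → ∀ {k} cs → length cs ≡ k →
    (f : Fin k → Carrier) → Injective _≡_ _≡_ f → (∀ i → evalMonic cs (f i) ≡ 0#) →
    ∀ {x} → evalMonic cs x ≡ 0# → ∃ λ i → x ≡ f i
  roots-exhausted _≟_ {k} cs refl f inj root {x} x-root with any? (λ i → x ≟ f i)
  ... | yes x∈f = x∈f
  ... | no  x∉f = ⊥-elim (n≮n k (roots-bound cs (x Vector.∷ f) x∷f-injective x∷f-root))
    where
    x∷f-injective : Injective _≡_ _≡_ (x Vector.∷ f)
    x∷f-injective {zero}  {zero}  _ = refl
    x∷f-injective {zero}  {suc j} e = ⊥-elim (x∉f (j , e))
    x∷f-injective {suc i} {zero}  e = ⊥-elim (x∉f (i , sym e))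
    x∷f-injective {suc i} {suc j} e = cong suc (inj e)
    x∷f-root : ∀ i → evalMonic cs ((x Vector.∷ f) i) ≡ 0#
    x∷f-root zero    = x-root
    x∷f-root (suc i) = root i

  X^[2+m]-X : ℕ → List Carrier
  X^[2+m]-X m = 0# ∷ - 1# ∷ replicate m 0#

  length-X^[2+m]-X : ∀ m → length (X^[2+m]-X m) ≡ suc (suc m)
  length-X^[2+m]-X m = cong (λ k → suc (suc k)) (length-replicate m)

  evalMonic-replicate-0 : ∀ m x → evalMonic (replicate m 0#) x ≡ x ^ m
  evalMonic-replicate-0 zero    x = refl
  evalMonic-replicate-0 (suc m) x = trans (+-identityˡ _) (cong (x *_) (evalMonic-replicate-0 m x))

  fixed⇒root-X^[2+m]-X : ∀ m {x} → x ^ suc (suc m) ≡ x → evalMonic (X^[2+m]-X m) x ≡ 0#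
  fixed⇒root-X^[2+m]-X m {x} fixed = begin
    0# + x * (- 1# + x * evalMonic (replicate m 0#) x)  ≡⟨ +-identityˡ _ ⟩
    x * (- 1# + x * evalMonic (replicate m 0#) x)       ≡⟨ cong (λ t → x * (- 1# + x * t)) (evalMonic-replicate-0 m x) ⟩
    x * (- 1# + x ^ suc m)                              ≡⟨ distribˡ x (- 1#) (x ^ suc m) ⟩
    x * - 1# + x ^ suc (suc m)                          ≡⟨ cong₂ _+_ (trans (*-comm x (- 1#)) (-1*x≈-x x)) fixed ⟩
    - x + x                                             ≡⟨ -‿inverseˡ x ⟩
    0#                                                  ∎

module FiniteProduct (K : Field) where
  open FieldArithmetic K
  open import Algebra.Properties.CommutativeMonoid.Sum *-commutativeMonoid public
    using () renaming (sum to ∏; ∑-distrib-+ to ∏-distrib-*; sum-permute to ∏-permute;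
                       sum-cong-≗ to ∏-cong; sum-remove to ∏-remove)
  open ≡-Reasoning

  ∏-const : ∀ n c → ∏ {n} (λ _ → c) ≡ c ^ n
  ∏-const zero    c = refl
  ∏-const (suc n) c = cong (c *_) (∏-const n c)

  ∏-≢0 : ∀ {n} (f : Fin n → Carrier) → (∀ i → f i ≢ 0#) → ∏ f ≢ 0#
  ∏-≢0 {zero}  f f≢0 = 0≢1 ∘ sym
  ∏-≢0 {suc n} f f≢0 = *-≢0 (f≢0 zero) (∏-≢0 (f ∘ suc) (f≢0 ∘ suc))

  ∏-agree-except : ∀ {n} (f g : Fin n → Carrier) i c → f i ≡ c * g i →
    (∀ j → j ≢ i → f j ≡ g j) → ∏ f ≡ c * ∏ g
  ∏-agree-except {suc n} f g i c fᵢ≡c*gᵢ agree = begin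
    ∏ f                              ≡⟨ ∏-remove f ⟩
    f i * ∏ (removeAt f i)           ≡⟨ cong₂ _*_ fᵢ≡c*gᵢ (∏-cong λ j → agree (punchIn i j) (punchInᵢ≢i i j)) ⟩
    c * g i * ∏ (removeAt g i)       ≡⟨ *-assoc c (g i) _ ⟩
    c * (g i * ∏ (removeAt g i))     ≡⟨ cong (c *_) (∏-remove g) ⟨
    c * ∏ g                          ∎

module FiniteSubset (K : Field) (_≟_ : DecidableEquality (Field.Carrier K)) (S : Subset K)
                    {Q : ℕ} (enumeration : HasSize K S Q) where
  open FieldArithmetic K
  open FiniteProduct K
  open Inverse enumeration using (to; from; strictlyInverseˡ; strictlyInverseʳ)
  open ≡-Reasoning

  infix 4 _∈S
  _∈S : Carrier → Set
  y ∈S = _∈_ K y S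

  Element : Set
  Element = Σ Carrier _∈S

  Element-≡ : ∀ {y z} {p : y ∈S} {q : z ∈S} → y ≡ z → (y , p) ≡ (z , q)
  Element-≡ refl = cong (_ ,_) (Decidable⇒UIP.≡-irrelevant Bool._≟_ _ _)

  element : Fin Q → Carrier
  element i = proj₁ (from i)

  element∈S : ∀ i → element i ∈S
  element∈S i = proj₂ (from i)

  element-injective : Injective _≡_ _≡_ element
  element-injective {i} {j} eᵢ≡eⱼ = begin
    i              ≡⟨ strictlyInverseˡ i ⟨
    to (from i)    ≡⟨ cong to (Element-≡ eᵢ≡eⱼ) ⟩
    to (from j)    ≡⟨ strictlyInverseˡ j ⟩
    j              ∎

  element-index : ∀ {y} (y∈S : y ∈S) → element (to (y , y∈S)) ≡ y
  element-index y∈S = cong proj₁ (strictlyInverseʳ (_ , y∈S))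

  -- Replacing 0 by 1 makes the product over S the product over S ∖ {0}.
  nonzeroPart : Carrier → Carrier
  nonzeroPart y with y ≟ 0#
  ... | yes _ = 1#
  ... | no  _ = y

  nonzeroPart≢0 : ∀ y → nonzeroPart y ≢ 0#
  nonzeroPart≢0 y with y ≟ 0#
  ... | yes _   = 0≢1 ∘ sym
  ... | no  y≢0 = y≢0

  nonzeroPart-≢0 : ∀ {y} → y ≢ 0# → nonzeroPart y ≡ y
  nonzeroPart-≢0 {y} y≢0 with y ≟ 0#
  ... | yes y≡0 = ⊥-elim (y≢0 y≡0)
  ... | no  _   = refl

  module _ {x} (x≢0 : x ≢ 0#) (xS≡S : ScaleEq K x S) where

    scaling : Element ↔ Element
    scaling = mk↔ₛ′ (λ (y , y∈S) → x * y , Equivalence.to (xS≡S (x * y)) (y , y∈S , refl))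
                    (λ (y , y∈S) → let (z , z∈S , _) = Equivalence.from (xS≡S y) y∈S in z , z∈S)
                    (λ (y , y∈S) → Element-≡ (sym (proj₂ (proj₂ (Equivalence.from (xS≡S y) y∈S)))))
                    (λ (y , y∈S) → Element-≡ (sym (*-cancelˡ _ _ x≢0
                      (proj₂ (proj₂ (Equivalence.from (xS≡S (x * y)) _))))))

    scalingPermutation : Permutation Q Q
    scalingPermutation = enumeration ↔-∘ (scaling ↔-∘ ↔-sym enumeration)

    element-scalingPermutation : ∀ i → element (scalingPermutation ⟨$⟩ʳ i) ≡ x * element i
    element-scalingPermutation i = cong proj₁ (strictlyInverseʳ (Inverse.to scaling (from i)))

    -- With h = nonzeroPart: x ^ Q · ∏ h(S) = ∏ x · h(S) = x · ∏ h(x S) = x · ∏ h(S),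
    -- since x · h(y) = h(x y) except at y = 0.
    stabiliser⇒x^Q≡x : 0# ∈S → x ^ Q ≡ x
    stabiliser⇒x^Q≡x 0∈S = *-cancelˡ (x ^ Q) x (∏-≢0 h∘e (nonzeroPart≢0 ∘ element)) (begin
      ∏ h∘e * x ^ Q                             ≡⟨ *-comm _ (x ^ Q) ⟩
      x ^ Q * ∏ h∘e                             ≡⟨ cong (_* ∏ h∘e) (∏-const Q x) ⟨
      ∏ {Q} (λ _ → x) * ∏ h∘e                   ≡⟨ ∏-distrib-* (λ _ → x) h∘e ⟨
      ∏ (λ i → x * h∘e i)                       ≡⟨ ∏-agree-except _ _ i₀ x zero-case nonzero-case ⟩
      x * ∏ (λ i → nonzeroPart (x * element i)) ≡⟨ cong (x *_) (∏-cong (cong nonzeroPart ∘ element-scalingPermutation)) ⟨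
      x * ∏ (h∘e ∘ (scalingPermutation ⟨$⟩ʳ_))  ≡⟨ cong (x *_) (∏-permute h∘e scalingPermutation) ⟨
      x * ∏ h∘e                                 ≡⟨ *-comm x _ ⟩
      ∏ h∘e * x                                 ∎)
      where
      h∘e : Fin Q → Carrier
      h∘e = nonzeroPart ∘ element
      i₀ : Fin Q
      i₀ = to (0# , 0∈S)
      zero-case : x * h∘e i₀ ≡ x * nonzeroPart (x * element i₀)
      zero-case = cong (λ t → x * nonzeroPart t)
                       (trans (element-index 0∈S) (sym (trans (cong (x *_) (element-index 0∈S)) (zeroʳ x))))
      nonzero-case : ∀ j → j ≢ i₀ → x * h∘e j ≡ nonzeroPart (x * element j)
      nonzero-case j j≢i₀ = trans (cong (x *_) (nonzeroPart-≢0 eⱼ≢0)) (sym (nonzeroPart-≢0 (*-≢0 x≢0 eⱼ≢0)))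
        where
        eⱼ≢0 : element j ≢ 0#
        eⱼ≢0 eⱼ≡0 = j≢i₀ (element-injective (trans eⱼ≡0 (sym (element-index 0∈S))))

module Characterisation (K : Field) (_≟_ : DecidableEquality (Field.Carrier K)) (S : Subset K)
    {m : ℕ} (enumeration : HasSize K S (suc (suc m))) (0∈S : _∈_ K (Field.0# K) S)
    (dichotomy : ∀ β → ScaleEq K β S ⊎ ScaleMeetZero K β S) where
  open FieldArithmetic K
  open MonicPolynomial K
  open FiniteSubset K _≟_ S enumeration

  Fixed : Carrier → Set
  Fixed x = x ^ suc (suc m) ≡ x

  nonzero-element : ∃ λ s → s ∈S × s ≢ 0#
  nonzero-element with element zero ≟ 0#
  ... | no  e₀≢0 = element zero , element∈S zero , e₀≢0
  ... | yes e₀≡0 = element (suc zero) , element∈S (suc zero) ,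
                   λ e₁≡0 → 0≢1+n (element-injective (trans e₀≡0 (sym e₁≡0)))

  s : Carrier
  s = proj₁ nonzero-element

  s∈S : s ∈S
  s∈S = proj₁ (proj₂ nonzero-element)

  s≢0 : s ≢ 0#
  s≢0 = proj₂ (proj₂ nonzero-element)

  s⁻¹ : Carrier
  s⁻¹ = proj₁ (inverse s s≢0)

  s*s⁻¹≡1 : s * s⁻¹ ≡ 1#
  s*s⁻¹≡1 = proj₂ (inverse s s≢0)

  s⁻¹≢0 : s⁻¹ ≢ 0#
  s⁻¹≢0 s⁻¹≡0 = 0≢1 (trans (sym (zeroʳ s)) (trans (cong (s *_) (sym s⁻¹≡0)) s*s⁻¹≡1))

  meets⇒stabilises : ∀ {β y z} → z ∈S → y ∈S → y ≢ 0# → y ≡ β * z → ScaleEq K β S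
  meets⇒stabilises {β} {y} z∈S y∈S y≢0 y≡βz with dichotomy β
  ... | inj₁ βS≡S  = βS≡S
  ... | inj₂ βS∩S≡0 = ⊥-elim (y≢0 (Equivalence.to (βS∩S≡0 y) ((_ , z∈S , y≡βz) , y∈S)))

  ∈S⇒∈s·Fixed : ∀ {y} → y ∈S → ∃ λ x → Fixed x × y ≡ s * x
  ∈S⇒∈s·Fixed {y} y∈S with y ≟ 0#
  ... | yes y≡0 = 0# , 0^n≡0 {suc (suc m)} z<s , trans y≡0 (sym (zeroʳ s))
  ... | no  y≢0 = s⁻¹ * y , stabiliser⇒x^Q≡x s⁻¹y≢0 s⁻¹yS≡S 0∈S , sym (x*[x′*y]≡y s*s⁻¹≡1 y)
    where
    s⁻¹y≢0 = *-≢0 s⁻¹≢0 y≢0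
    s⁻¹yS≡S = meets⇒stabilises s∈S y∈S y≢0
                (trans (sym (x*[x′*y]≡y s*s⁻¹≡1 y)) (*-comm s _))

  s⁻¹e : Fin (suc (suc m)) → Carrier
  s⁻¹e i = s⁻¹ * element i

  s⁻¹e-injective : Injective _≡_ _≡_ s⁻¹e
  s⁻¹e-injective = element-injective ∘ *-cancelˡ _ _ s⁻¹≢0

  s⁻¹e-root : ∀ i → evalMonic (X^[2+m]-X m) (s⁻¹e i) ≡ 0#
  s⁻¹e-root i with ∈S⇒∈s·Fixed (element∈S i)
  ... | x , x-fixed , eᵢ≡sx = fixed⇒root-X^[2+m]-X m
    (subst Fixed (sym (trans (cong (s⁻¹ *_) eᵢ≡sx) (x′*[x*y]≡y s*s⁻¹≡1 x))) x-fixed)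

  Fixed⇒s*∈S : ∀ {x} → Fixed x → s * x ∈S
  Fixed⇒s*∈S x-fixed with roots-exhausted _≟_ (X^[2+m]-X m) (length-X^[2+m]-X m) s⁻¹e
                            s⁻¹e-injective s⁻¹e-root (fixed⇒root-X^[2+m]-X m x-fixed)
  ... | i , x≡s⁻¹eᵢ =
    subst _∈S (sym (trans (cong (s *_) x≡s⁻¹eᵢ) (x*[x′*y]≡y s*s⁻¹≡1 _))) (element∈S i)

  characterisation : Σ Carrier λ α → α ≢ 0# × (∀ y → y ∈S ⇔ (∃ λ x → Fixed x × y ≡ α * x))
  characterisation = s , s≢0 , λ y → mk⇔ ∈S⇒∈s·Fixed
    (λ (x , x-fixed , y≡sx) → subst _∈S (sym y≡sx) (Fixed⇒s*∈S x-fixed))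

linear⇒0∈S : (K : Field) {q : ℕ} {S : Subset K} → 0 < q → FqLinearClosed K q S →
  ∀ {y} → _∈_ K y S → _∈_ K (Field.0# K) S
linear⇒0∈S K {q} {S} 0<q linear {y} y∈S =
  subst (λ t → _∈_ K t S) 0*y+0*y≡0 (linear 0# 0# y y 0∈𝔽q 0∈𝔽q y∈S y∈S)
  where
  open FieldArithmetic K
  0∈𝔽q : Subfield K q 1 0#
  0∈𝔽q = 0^n≡0 (subst (0 <_) (sym (^-identityʳ q)) 0<q)
  0*y+0*y≡0 : 0# * y + 0# * y ≡ 0#
  0*y+0*y≡0 = trans (cong₂ _+_ (zeroˡ y) (zeroˡ y)) (+-identityˡ 0#)

¬Carrier↔Fin1 : (K : Field) → ¬ (Field.Carrier K ↔ Fin 1)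
¬Carrier↔Fin1 K K↔Fin1 =
  0≢1 (Injection.injective (↔⇒↣ K↔Fin1) (trans (Fin1-unique (to 0#)) (sym (Fin1-unique (to 1#)))))
  where
  open Field K using (0#; 1#; 0≢1)
  open Inverse K↔Fin1 using (to)
  Fin1-unique : ∀ (i : Fin 1) → i ≡ zero
  Fin1-unique zero = refl

primePower⇒1<q : ∀ {q} → IsPrimePower q → 1 < q
primePower⇒1<q (p , k , p-prime , refl) =
  ^-monoʳ-< p (nonTrivial⇒n>1 p {{prime⇒nonTrivial p-prime}}) (z<s {k})

lemma4p5 : (q n d : ℕ) → IsPrimePower q → (K : Field) → (Field.Carrier K ↔ Fin (q Data.Nat.^ n)) → (S : Subset K) → FqLinearClosed K q S → (∀ β → ScaleEq K β S ⊎ ScaleMeetZero K β S) → HasSize K S (q Data.Nat.^ d) → d ∣ n → Σ (Field.Carrier K) λ α → ¬ (α ≡ Field.0# K) × (∀ y → _∈_ K y S ⇔ (∃ λ x → Subfield K q d x × y ≡ Field._*_ K α x))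
lemma4p5 q n d q-primePower K K↔𝔽 S linear dichotomy size d∣n =
  scaledSubfield (^-monoʳ-< q 1<q 0<d) size
  where
  open Field K using (Carrier; 0#; _*_; _^_)
  1<q : 1 < q
  1<q = primePower⇒1<q q-primePower
  _≟_ : DecidableEquality Carrier
  _≟_ = via-injection (↔⇒↣ K↔𝔽) Fin._≟_
  n≢0 : n ≢ 0
  n≢0 refl = ¬Carrier↔Fin1 K K↔𝔽
  -- d ∣ n only serves to exclude d = 0, for which S = {0}.
  0<d : 0 < d
  0<d = n≢0⇒n>0 (λ d≡0 → n≢0 (0∣⇒≡0 (subst (_∣ n) d≡0 d∣n)))
  scaledSubfield : ∀ {Q} → 1 < Q → HasSize K S Q →
    Σ Carrier λ α → ¬ (α ≡ 0#) × (∀ y → _∈_ K y S ⇔ (∃ λ x → x ^ Q ≡ x × y ≡ α * x))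
  scaledSubfield {suc (suc m)} (s≤s (s≤s z≤n)) size =
    Characterisation.characterisation K _≟_ S size
      (linear⇒0∈S K (<-trans z<s 1<q) linear (proj₂ (Inverse.from size zero))) dichotomy
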